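{- Let $\lambda/\mu$ be a skew partition with $r=\mathrm{rank}(\lambda/\mu)$, let $\mathcal{I}_0=\{(w_1,y_1),\ldots,(w_r,y_r)\}$ be its unique interval set with zero crossings, and let $\epsilon$ be the smallest content of a square of $\lambda/\mu$. Let $\mathbf{D}=\{B_1,\ldots,B_r\}$ be any minimal border strip decomposition of $\lambda/\mu$, and put $P_{\mathbf{D}}=\{\tau(\mathrm{init}(B_1)),\ldots,\tau(\mathrm{init}(B_r))\}$ and $Q_{\mathbf{D}}=\{\tau(\mathrm{fin}(B_1)),\ldots,\tau(\mathrm{fin}(B_r))\}$. Then \[ P_{\mathbf{D}}=\{\epsilon+w_i-1: 1\le i\le r\}\quad\text{and}\quad Q_{\mathbf{D}}=\{\epsilon+y_i-2: 1\le i\le r\}. \] In particular $P_{\mathbf{D}}$ and $Q_{\mathbf{D}}$ do not depend on the choice of minimal border strip decomposition $\mathbf{D}$.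
   Context: A partition $\lambda$ has Young diagram $\{(i,j): 1\le i\le \ell(\lambda),\,1\le j\le\lambda_i\}$ (row $i$ from the top, column $j$ from the left); for $\mu\subseteq\lambda$ the skew partition $\lambda/\mu$ has diagram the diagram of $\lambda$ minus that of $\mu$. The content of square $(i,j)$ is $\tau((i,j))=j-i$. A border strip is a connected skew shape (connected interior) with no $2\times2$ square. A border strip decomposition of $\lambda/\mu$ is a partition of its squares into pairwise disjoint border strips; it is minimal if no border strip decomposition has fewer strips, and $\mathrm{rank}(\lambda/\mu)$ is the number of strips in a minimal one. For a border strip $B$, $\mathrm{init}(B)$ is its lower left-hand square and $\mathrm{fin}(B)$ its upper right-hand square. Snakes: consider the bottom-right boundary lattice path of the diagram of $\lambda/\mu$, with unit steps up or right, from the bottom-leftmost point to the top-rightmost point, with edges $e_1,\ldots,e_k$. For an edge $e$, if no square of $\lambda/\mu$ has $e$ as an edge, $S_e=\emptyset$; otherwise with $(i,j)$ the unique square having $e$ as an edge, $S_e=\lambda/\mu\cap\{(i,j),(i-1,j),(i-1,j-1),(i-2,j-1),\ldots\}$ if $e$ is horizontal and $S_e=\lambda/\mu\cap\{(i,j),(i,j-1),(i-1,j-1),(i-1,j-2),\ldots\}$ if $e$ is vertical. The length of a snake is its number of squares minus one. A right (resp. left) snake is one of even length arising from a horizontal (resp. vertical) edge. The snake sequence $q_1\cdots q_k$ replaces a left snake of length $2m$ by $L_m$, a right snake of length $2m$ by $R_m$, and an odd-length snake by $O$; it has exactly $r$ symbols of type $L$ and $r$ of type $R$. An interval set is a collection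 of $r$ pairs $\{(u_1,v_1),\ldots,(u_r,v_r)\}$ with the $u_i$ distinct, the $v_i$ distinct, $1\le u_i<v_i\le k$, $u_i\ne v_j$ for all $i,j$, $q_{u_i}$ of type $L$ and $q_{v_i}$ of type $R$. Its number of crossings is the number of pairs $(i,j)$ with $u_i<u_j<v_i<v_j$; it is known there is a unique interval set $\mathcal{I}_0$ with no crossings. -}

module Defs where

open import Data.Nat using (ℕ; zero; suc; _≤_; _<_; _≥_; _≤?_)
open import Data.Integer as ℤ using (ℤ; +_)
open import Data.List using (List; []; _∷_; length; lookup; filter; map; concat; upTo)
open import Data.List.Membership.Propositional using (_∈_)
open import Data.List.Relation.Unary.All using (All)
open import Data.List.Relation.Unary.Linked using (Linked)
open import Data.Fin using (Fin)
open import Data.Maybe using (Maybe; just; nothing)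
import Data.Maybe as Maybe
open import Data.Product using (Σ; _×_; _,_)
open import Data.Sum using (_⊎_)
open import Data.Unit using (⊤)
open import Data.Empty using (⊥)
open import Data.Bool using (if_then_else_)
open import Relation.Nullary using (¬_; Dec; does)
open import Relation.Nullary.Decidable using (_×-dec_; ¬?)
open import Relation.Binary.PropositionalEquality using (_≡_; _≢_)
open import Function.Bundles using (_⇔_)

-- Partitions and diagrams.  A partition is a weakly decreasing list of
-- positive integers.  Squares are pairs (i , j) = (row , column), both
-- starting at 1 (row 1 at the top).

Cell : Set
Cell = ℕ × ℕ

IsPartition : List ℕ → Set
IsPartition p = Linked _≥_ p × All (λ x → 1 ≤ x) p

-- the i-th part (1-indexed), 0 beyond the length
part : List ℕ → ℕ → ℕ
part _ zero = 0
part [] (suc i) = 0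
part (x ∷ xs) (suc zero) = x
part (x ∷ xs) (suc (suc i)) = part xs (suc i)

InDiag : List ℕ → Cell → Set
InDiag p (i , j) = (1 ≤ i) × (1 ≤ j) × (j ≤ part p i)

inDiag? : (p : List ℕ) → (c : Cell) → Dec (InDiag p c)
inDiag? p (i , j) = (1 ≤? i) ×-dec ((1 ≤? j) ×-dec (j ≤? part p i))

_⊆ₚ_ : List ℕ → List ℕ → Set
mu ⊆ₚ la = ∀ i → part mu i ≤ part la i

InSkew : List ℕ → List ℕ → Cell → Set
InSkew la mu c = InDiag la c × ¬ InDiag mu c

inSkew? : (la mu : List ℕ) → (c : Cell) → Dec (InSkew la mu c)
inSkew? la mu c = inDiag? la c ×-dec ¬? (inDiag? mu c)

row col : Cell → ℕ
row (i , j) = i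
col (i , j) = j

τ : Cell → ℤ
τ (i , j) = (+ j) ℤ.- (+ i)

-- Border strips and border strip decompositions.
-- A border strip is given as a list of squares (read as a finite set).

Adj : Cell → Cell → Set
Adj (i , j) (i' , j') =
  (i ≡ i' × (suc j ≡ j' ⊎ j ≡ suc j')) ⊎ (j ≡ j' × (suc i ≡ i' ⊎ i ≡ suc i'))

data Reach (B : List Cell) : Cell → Cell → Set where
  here : ∀ {c} → Reach B c c
  step : ∀ {c d e} → Adj c d → d ∈ B → Reach B d e → Reach B c e

Connected : List Cell → Set
Connected B = ∀ c d → c ∈ B → d ∈ B → Reach B c d

NoTwoByTwo : List Cell → Set
NoTwoByTwo B = ∀ i j →
  ¬ (((i , j) ∈ B) × ((suc i , j) ∈ B) × ((i , suc j) ∈ B) × ((suc i , suc j) ∈ B))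

IsSkewShape : List Cell → Set
IsSkewShape B = Σ (List ℕ) λ nu → Σ (List ℕ) λ rho →
  IsPartition nu × IsPartition rho × rho ⊆ₚ nu × (∀ c → (c ∈ B) ⇔ InSkew nu rho c)

NonEmpty : List Cell → Set
NonEmpty B = Σ Cell λ c → c ∈ B

IsBorderStrip : List Cell → Set
IsBorderStrip B = NonEmpty B × IsSkewShape B × Connected B × NoTwoByTwo B

IsBSD : List ℕ → List ℕ → List (List Cell) → Set
IsBSD la mu D =
  All IsBorderStrip D
  × (∀ (k : Fin (length D)) c → c ∈ lookup D k → InSkew la mu c)
  × (∀ (k l : Fin (length D)) c → c ∈ lookup D k → c ∈ lookup D l → k ≡ l)
  × (∀ c → InSkew la mu c → Σ (Fin (length D)) λ k → c ∈ lookup D k)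

-- minimal border strip decomposition (its length is rank(λ/μ))
IsMinimalBSD : List ℕ → List ℕ → List (List Cell) → Set
IsMinimalBSD la mu D =
  IsBSD la mu D × (∀ D' → IsBSD la mu D' → length D ≤ length D')

IsInit : List Cell → Cell → Set
IsInit B c = c ∈ B × (∀ d → d ∈ B → (row d ≤ row c) × (row d ≡ row c → col c ≤ col d))

IsFin : List Cell → Cell → Set
IsFin B c = c ∈ B × (∀ d → d ∈ B → (row c ≤ row d) × (row d ≡ row c → col d ≤ col c))

InP : List (List Cell) → ℤ → Set
InP D z = Σ (Fin (length D)) λ k → Σ Cell λ c → IsInit (lookup D k) c × z ≡ τ c

InQ : List (List Cell) → ℤ → Set
InQ D z = Σ (Fin (length D)) λ k → Σ Cell λ c → IsFin (lookup D k) c × z ≡ τ c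

IsMinContent : List ℕ → List ℕ → ℤ → Set
IsMinContent la mu ε =
  (Σ Cell λ c → InSkew la mu c × τ c ≡ ε) × (∀ c → InSkew la mu c → ε ℤ.≤ τ c)

-- Unit edges adjacent to a square (i , j):
--   H i j = bottom edge of (i , j), from point (x,y)=(j-1,i) to (j,i)
--   V i j = right edge of (i , j),  from point (j,i) to (j,i-1)
-- (lattice points (x , y): x = column line, y = row line counted downwards)
data Edge : Set where
  H V : ℕ → ℕ → Edge

edgeCell : Edge → Cell
edgeCell (H i j) = (i , j)
edgeCell (V i j) = (i , j)

-- diagonal x - y of the starting point of the edge (each unit step of a
-- right/up lattice path increases x - y by one)
startDiag : Edge → ℤ
startDiag (H i j) = (+ j) ℤ.- (+ 1) ℤ.- (+ i)
startDiag (V i j) = (+ j) ℤ.- (+ i)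

BoundaryEdge : List ℕ → Edge → Set
BoundaryEdge la (H i j) = InDiag la (i , j) × ¬ InDiag la (suc i , j)
BoundaryEdge la (V i j) = InDiag la (i , j) × ¬ InDiag la (i , suc j)

BottomLeftCell : List ℕ → List ℕ → Cell → Set
BottomLeftCell la mu c = InSkew la mu c ×
  (∀ d → InSkew la mu d → (row d ≤ row c) × (row d ≡ row c → col c ≤ col d))

TopRightCell : List ℕ → List ℕ → Cell → Set
TopRightCell la mu c = InSkew la mu c ×
  (∀ d → InSkew la mu d → (row c ≤ row d) × (row d ≡ row c → col d ≤ col c))

-- e is the t-th edge e_t (1 ≤ t ≤ k) of the bottom-right boundary lattice
-- path of λ/μ, which runs along the boundary of λ from the lower-left
-- corner of the bottom-leftmost square s (diagonal τ s - 1) to the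
-- upper-right corner of the top-rightmost square f (diagonal τ f + 1),
-- so k = τ f - τ s + 2.
PathEdge : List ℕ → List ℕ → ℕ → Edge → Set
PathEdge la mu t e = Σ Cell λ s → Σ Cell λ f →
  BottomLeftCell la mu s × TopRightCell la mu f
  × (1 ≤ t) × ((+ t) ℤ.≤ τ f ℤ.- τ s ℤ.+ (+ 2))
  × BoundaryEdge la e
  × (startDiag e ≡ τ s ℤ.- (+ 1) ℤ.+ ((+ t) ℤ.- (+ 1)))

snakeCandidates : Edge → List Cell
snakeCandidates (H i j) =
  concat (map (λ m → (i Data.Nat.∸ m , j Data.Nat.∸ m) ∷ (i Data.Nat.∸ m , j Data.Nat.∸ m Data.Nat.∸ 1) ∷ []) (upTo i))
snakeCandidates (V i j) =
  concat (map (λ m → (i Data.Nat.∸ m , j Data.Nat.∸ m) ∷ (i Data.Nat.∸ m Data.Nat.∸ 1 , j Data.Nat.∸ m) ∷ []) (upTo i))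

snake : List ℕ → List ℕ → Edge → List Cell
snake la mu e =
  if does (inSkew? la mu (edgeCell e))
  then filter (inSkew? la mu) (snakeCandidates e)
  else []

data Sym : Set where
  L R : ℕ → Sym
  O : Sym

half : ℕ → Maybe ℕ
half zero = just zero
half (suc zero) = nothing
half (suc (suc n)) = Maybe.map suc (half n)

symOf : Edge → Maybe ℕ → Sym
symOf (H _ _) (just m) = L m
symOf (V _ _) (just m) = R m
symOf _ nothing = O

snakeSym : List ℕ → List ℕ → Edge → Sym
snakeSym la mu e with length (snake la mu e)
... | zero = O
... | suc n = symOf e (half n)

IsLType IsRType : Sym → Set
IsLType (L _) = ⊤
IsLType _ = ⊥
IsRType (R _) = ⊤
IsRType _ = ⊥

QIsL QIsR : List ℕ → List ℕ → ℕ → Set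
QIsL la mu t = Σ Edge λ e → PathEdge la mu t e × IsLType (snakeSym la mu e)
QIsR la mu t = Σ Edge λ e → PathEdge la mu t e × IsRType (snakeSym la mu e)

IsIntervalSet : List ℕ → List ℕ → (r : ℕ) → (u v : Fin r → ℕ) → Set
IsIntervalSet la mu r u v =
  (∀ i j → u i ≡ u j → i ≡ j)
  × (∀ i j → v i ≡ v j → i ≡ j)
  × (∀ i → u i < v i)
  × (∀ i j → u i ≢ v j)
  × (∀ i → QIsL la mu (u i))
  × (∀ i → QIsR la mu (v i))

NoCrossings : (r : ℕ) → (u v : Fin r → ℕ) → Set
NoCrossings r u v = ∀ i j → ¬ ((u i < u j) × (u j < v i) × (v i < v j))

-- Take the horizontal edge of an L-position, with square (i , j), and read its snake
-- in pairs: the diagonal square x_m = (i - m , j - m) followed by its left neighbour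
-- y_m.  Suppose no strip of D starts on the diagonal of (i , j).  A strip containing
-- x_m is connected and its initial square has smaller content, so it has a square of
-- content τ(x_m) - 1, and convexity forces that square to be y_m or the square below
-- x_m.  Below x_0 lies outside λ, and below x_{m+1} lies y_m, which by induction
-- shares its strip with x_m; but two squares of one diagonal in a border strip would
-- span a 2×2 square.  So x_m and y_m are both in λ/μ or both outside, the snake has
-- an even number of squares, and it cannot be an L-snake.  Hence each of the r
-- L-positions w_i gives a strip whose initial square has content ε + w_i - 1; these
-- strips are distinct, and as D has r strips they are all of them.  Dually for the
-- R-positions and final squares.

module Submission where

open import Defs
open import Data.Nat using (ℕ)
open import Data.Integer using (ℤ; +_; _+_; _-_)
open import Data.List using (List; length)
open import Data.Fin using (Fin)
open import Data.Product using (Σ; _×_)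
open import Relation.Binary.PropositionalEquality using (_≡_)
open import Function.Bundles using (_⇔_)

open import Data.Nat as ℕ using (zero; suc; z≤n; s≤s; _∸_; _≤′_; ≤′-refl; ≤′-step)
import Data.Nat.Properties as ℕₚ
import Data.Integer as ℤ
import Data.Integer.Properties as ℤₚ
open import Data.Integer.Tactic.RingSolver using (solve-∀)
open import Data.List using ([]; _∷_; lookup; filter; map; concat; upTo)
import Data.List.Properties as Listₚ
open import Data.List.Membership.Propositional using (_∈_)
open import Data.List.Membership.Propositional.Properties using (∈-lookup)
open import Data.List.Relation.Unary.Any using (here; there)
import Data.List.Relation.Unary.All as All
open import Data.List.Relation.Unary.Linked using (Linked; []; [-]; _∷_)
import Data.Fin as Fin
import Data.Fin.Properties as Finₚ
open import Data.Product using (_,_; proj₁; proj₂)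
open import Data.Sum as Sum using (_⊎_; inj₁; inj₂)
open import Data.Empty using (⊥; ⊥-elim)
open import Data.Maybe as Maybe using (just; nothing)
open import Function using (_∘_; id)
open import Function.Definitions using (Injective)
open import Function.Bundles using (Equivalence; mk⇔)
open import Level using (0ℓ)
open import Relation.Binary using (Rel; Total; Transitive; tri<; tri≈; tri>)
open import Relation.Nullary using (¬_; Dec; yes; no; contradiction)
open import Relation.Nullary.Decidable using (dec-true; dec-false; decidable-stable)
open import Relation.Unary using (Decidable)
open import Relation.Binary.PropositionalEquality
  using (_≢_; refl; sym; trans; cong; cong₂; subst; module ≡-Reasoning)

τ-right : ∀ i j → τ (i , suc j) ≡ ℤ.suc (τ (i , j))
τ-right i j = shift (+ j) (+ i)
  where
  shift : ∀ a b → (ℤ.1ℤ + a) - b ≡ ℤ.1ℤ + (a - b)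
  shift = solve-∀

τ-below : ∀ i j → τ (suc i , j) ≡ ℤ.pred (τ (i , j))
τ-below i j = shift (+ j) (+ i)
  where
  shift : ∀ a b → a - (ℤ.1ℤ + b) ≡ ℤ.-1ℤ + (a - b)
  shift = solve-∀

τ-+ : ∀ i j k → τ (i , j) + + (i ℕ.+ k) ≡ + (j ℕ.+ k)
τ-+ i j k = cancel (+ j) (+ i) (+ k)
  where
  cancel : ∀ a b c → (a - b) + (b + c) ≡ a + c
  cancel = solve-∀

τ-as-difference : ∀ i j k → τ (i , j) ≡ + (j ℕ.+ k) - + (i ℕ.+ k)
τ-as-difference i j k = extend (+ j) (+ i) (+ k)
  where
  extend : ∀ a b c → a - b ≡ (a + c) - (b + c)
  extend = solve-∀

τ≡τ⇒+≡+ : ∀ i j i′ j′ → τ (i , j) ≡ τ (i′ , j′) → j ℕ.+ i′ ≡ j′ ℕ.+ i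
τ≡τ⇒+≡+ i j i′ j′ eq = ℤₚ.+-injective (begin
  + (j ℕ.+ i′)                 ≡⟨ τ-+ i j i′ ⟨
  τ (i , j) + + (i ℕ.+ i′)     ≡⟨ cong₂ _+_ eq (cong +_ (ℕₚ.+-comm i i′)) ⟩
  τ (i′ , j′) + + (i′ ℕ.+ i)   ≡⟨ τ-+ i′ j′ i ⟩
  + (j′ ℕ.+ i)                 ∎)
  where open ≡-Reasoning

+≤+⇒τ≤τ : ∀ i j i′ j′ → j ℕ.+ i′ ℕ.≤ j′ ℕ.+ i → τ (i , j) ℤ.≤ τ (i′ , j′)
+≤+⇒τ≤τ i j i′ j′ le = begin
  τ (i , j)                         ≡⟨ τ-as-difference i j i′ ⟩
  + (j ℕ.+ i′) - + (i ℕ.+ i′)       ≤⟨ ℤₚ.+-monoˡ-≤ (ℤ.- + (i ℕ.+ i′)) (ℤ.+≤+ le) ⟩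
  + (j′ ℕ.+ i) - + (i ℕ.+ i′)       ≡⟨ cong (λ k → + (j′ ℕ.+ i) - + k) (ℕₚ.+-comm i i′) ⟩
  + (j′ ℕ.+ i) - + (i′ ℕ.+ i)       ≡⟨ τ-as-difference i′ j′ i ⟨
  τ (i′ , j′)                       ∎
  where open ℤₚ.≤-Reasoning

τ-diagonal : ∀ i j m → m ℕ.≤ i → m ℕ.≤ j → τ (i ∸ m , j ∸ m) ≡ τ (i , j)
τ-diagonal i j m m≤i m≤j = begin
  τ (i ∸ m , j ∸ m)                    ≡⟨ τ-as-difference (i ∸ m) (j ∸ m) m ⟩
  + (j ∸ m ℕ.+ m) - + (i ∸ m ℕ.+ m)    ≡⟨ cong₂ (λ a b → + a - + b) (ℕₚ.m∸n+n≡m m≤j) (ℕₚ.m∸n+n≡m m≤i) ⟩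
  τ (i , j)                            ∎
  where open ≡-Reasoning

τ-adjacent : ∀ c d → Adj c d → τ d ≡ ℤ.suc (τ c) ⊎ τ d ≡ ℤ.pred (τ c)
τ-adjacent (i , j) (.i , .(suc j)) (inj₁ (refl , inj₁ refl)) = inj₁ (τ-right i j)
τ-adjacent (i , .(suc j)) (.i , j) (inj₁ (refl , inj₂ refl)) =
  inj₂ (sym (trans (cong ℤ.pred (τ-right i j)) (ℤₚ.pred-suc (τ (i , j)))))
τ-adjacent (i , j) (.(suc i) , .j) (inj₂ (refl , inj₁ refl)) = inj₂ (τ-below i j)
τ-adjacent (.(suc i) , j) (i , .j) (inj₂ (refl , inj₂ refl)) =
  inj₁ (sym (trans (cong ℤ.suc (τ-below i j)) (ℤₚ.suc-pred (τ (i , j)))))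

reach-intermediate-content : ∀ {B c e} v → Reach B c e → c ∈ B → τ c ℤ.≤ v → v ℤ.≤ τ e →
                             Σ Cell λ d → d ∈ B × τ d ≡ v
reach-intermediate-content v here c∈B c≤v v≤e = _ , c∈B , ℤₚ.≤-antisym c≤v v≤e
reach-intermediate-content {c = c} v (step {d = d} c~d d∈B d⇝e) c∈B c≤v v≤e with τ c ℤ.≟ v
... | yes c≡v = c , c∈B , c≡v
... | no c≢v = reach-intermediate-content v d⇝e d∈B d≤v v≤e
  where
  d≤v : τ d ℤ.≤ v
  d≤v with τ-adjacent c d c~d
  ... | inj₁ eq = subst (ℤ._≤ v) (sym eq) (ℤₚ.i<j⇒suc[i]≤j (ℤₚ.≤∧≢⇒< c≤v c≢v))
  ... | inj₂ eq = subst (ℤ._≤ v) (sym eq) (ℤₚ.i≤j⇒pred[i]≤j c≤v)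

part-suc-≤ : ∀ {p} → Linked ℕ._≥_ p → ∀ n → part p (suc (suc n)) ℕ.≤ part p (suc n)
part-suc-≤ [] n = z≤n
part-suc-≤ [-] n = z≤n
part-suc-≤ (x≥y ∷ _) zero = x≥y
part-suc-≤ (_ ∷ lk) (suc n) = part-suc-≤ lk n

part-antitone : ∀ {p a b} → Linked ℕ._≥_ p → suc a ≤′ b → part p b ℕ.≤ part p (suc a)
part-antitone _ ≤′-refl = ℕₚ.≤-refl
part-antitone {b = suc zero} _ (≤′-step (ℕ.≤′-reflexive ()))
part-antitone {b = suc (suc n)} lk (≤′-step a<b) = ℕₚ.≤-trans (part-suc-≤ lk n) (part-antitone lk a<b)

_≼_ : Cell → Cell → Set
(i , j) ≼ (i′ , j′) = i ℕ.≤ i′ × j ℕ.≤ j′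

Convex : (Cell → Set) → Set
Convex P = ∀ a b c → P a → P c → a ≼ b → b ≼ c → P b

InDiag-downClosed : ∀ {p i j i′ j′} → Linked ℕ._≥_ p → InDiag p (i , j) →
                    1 ℕ.≤ i′ → 1 ℕ.≤ j′ → i′ ℕ.≤ i → j′ ℕ.≤ j → InDiag p (i′ , j′)
InDiag-downClosed lk (_ , _ , j≤part) (s≤s z≤n) 1≤j′ i′≤i j′≤j =
  s≤s z≤n , 1≤j′ , ℕₚ.≤-trans j′≤j (ℕₚ.≤-trans j≤part (part-antitone lk (ℕₚ.≤⇒≤′ i′≤i)))

InSkew-convex : ∀ {la mu} → Linked ℕ._≥_ la → Linked ℕ._≥_ mu → Convex (InSkew la mu)
InSkew-convex lkλ lkμ a b c (a∈λ , a∉μ) (c∈λ , _) (a₁ , a₂) (b₁ , b₂) =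
  InDiag-downClosed lkλ c∈λ (ℕₚ.≤-trans (proj₁ a∈λ) a₁) (ℕₚ.≤-trans (proj₁ (proj₂ a∈λ)) a₂) b₁ b₂ ,
  λ b∈μ → a∉μ (InDiag-downClosed lkμ b∈μ (proj₁ a∈λ) (proj₁ (proj₂ a∈λ)) a₁ a₂)

skewShape-convex : ∀ {B} → IsSkewShape B → Convex (_∈ B)
skewShape-convex (_ , _ , (lkν , _) , (lkρ , _) , _ , B≡ν/ρ) a b c a∈B c∈B a≼b b≼c =
  Equivalence.from (B≡ν/ρ b) (InSkew-convex lkν lkρ a b c (Equivalence.to (B≡ν/ρ a) a∈B) (Equivalence.to (B≡ν/ρ c) c∈B) a≼b b≼c)

-- Convex sets without 2×2 squares

No2×2 : (Cell → Set) → Set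
No2×2 P = ∀ i j → ¬ (P (i , j) × P (suc i , j) × P (i , suc j) × P (suc i , suc j))

same-diagonal-< : ∀ {i j i′ j′} → j ℕ.+ i′ ≡ j′ ℕ.+ i → i ℕ.< i′ → j ℕ.< j′
same-diagonal-< {i} {j} {i′} {j′} eq i<i′ = ℕₚ.≰⇒> λ j′≤j →
  ℕₚ.<-irrefl (sym eq) (ℕₚ.≤-<-trans (ℕₚ.+-monoˡ-≤ i j′≤j) (ℕₚ.+-monoʳ-< j i<i′))

module _ {P : Cell → Set} (convex : Convex P) (no2×2 : No2×2 P) where

  no-increasing-pair : ∀ {i j i′ j′} → P (i , j) → P (i′ , j′) → i ℕ.< i′ → j ℕ.< j′ → ⊥
  no-increasing-pair {i} {j} {i′} {j′} p p′ i<i′ j<j′ =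
    no2×2 i j (p , between (suc i , j) (ℕₚ.n≤1+n i , ℕₚ.≤-refl) (i<i′ , ℕₚ.<⇒≤ j<j′)
                 , between (i , suc j) (ℕₚ.≤-refl , ℕₚ.n≤1+n j) (ℕₚ.<⇒≤ i<i′ , j<j′)
                 , between (suc i , suc j) (ℕₚ.n≤1+n i , ℕₚ.n≤1+n j) (i<i′ , j<j′))
    where
    between : ∀ b → (i , j) ≼ b → b ≼ (i′ , j′) → P b
    between b = convex (i , j) b (i′ , j′) p p′

  diagonal-unique : ∀ {c d} → P c → P d → τ c ≡ τ d → c ≡ d
  diagonal-unique {i , j} {i′ , j′} p p′ eq with τ≡τ⇒+≡+ i j i′ j′ eq | ℕₚ.<-cmp i i′
  ... | e | tri< i<i′ _ _ = ⊥-elim (no-increasing-pair p p′ i<i′ (same-diagonal-< e i<i′))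
  ... | e | tri> _ _ i′<i = ⊥-elim (no-increasing-pair p′ p i′<i (same-diagonal-< (sym e) i′<i))
  ... | e | tri≈ _ refl _ = cong (i ,_) (ℕₚ.+-cancelʳ-≡ i j j′ e)

  -- Whichever of (row d , suc (col d)) and (suc (row c) , col c) lies between c and d
  -- has the content of c resp. d, so diagonal-unique identifies it with that square.
  consecutive-diagonals : ∀ {c d} → P c → P d → τ c ≡ ℤ.suc (τ d) →
                          c ≡ (row d , suc (col d)) ⊎ d ≡ (suc (row c) , col c)
  consecutive-diagonals {p , q} {a , b} pc pd eq = split (a ℕ.≤? p)
    where
    e : suc b ℕ.+ p ≡ q ℕ.+ a
    e = τ≡τ⇒+≡+ a (suc b) p q (trans (τ-right a b) (sym eq))

    split : Dec (a ℕ.≤ p) → (p , q) ≡ (a , suc b) ⊎ (a , b) ≡ (suc p , q)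
    split (yes a≤p) = inj₁ (diagonal-unique pc right (trans eq (sym (τ-right a b))))
      where
      sb≤q : suc b ℕ.≤ q
      sb≤q = ℕₚ.+-cancelʳ-≤ p (suc b) q (subst (ℕ._≤ q ℕ.+ p) (sym e) (ℕₚ.+-monoʳ-≤ q a≤p))
      right : P (a , suc b)
      right = convex (a , b) (a , suc b) (p , q) pd pc (ℕₚ.≤-refl , ℕₚ.n≤1+n b) (a≤p , sb≤q)
    split (no a≰p) = inj₂ (diagonal-unique pd below
      (sym (trans (τ-below p q) (trans (cong ℤ.pred eq) (ℤₚ.pred-suc (τ (a , b)))))))
      where
      p<a : p ℕ.< a
      p<a = ℕₚ.≰⇒> a≰p
      q≤b : q ℕ.≤ b
      q≤b = ℕₚ.+-cancelʳ-≤ (suc p) q b (begin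
        q ℕ.+ suc p   ≤⟨ ℕₚ.+-monoʳ-≤ q p<a ⟩
        q ℕ.+ a       ≡⟨ e ⟨
        suc b ℕ.+ p   ≡⟨ ℕₚ.+-suc b p ⟨
        b ℕ.+ suc p   ∎)
        where open ℕₚ.≤-Reasoning
      below : P (suc p , q)
      below = convex (p , q) (suc p , q) (a , b) pc pd (ℕₚ.n≤1+n p , ℕₚ.≤-refl) (p<a , q≤b)

_≤↙_ : Cell → Cell → Set
d ≤↙ c = row d ℕ.≤ row c × (row d ≡ row c → col c ℕ.≤ col d)

_≤↗_ : Cell → Cell → Set
d ≤↗ c = row c ℕ.≤ row d × (row d ≡ row c → col d ℕ.≤ col c)

≤↙-total : Total _≤↙_
≤↙-total (i , j) (i′ , j′) with ℕₚ.<-cmp i i′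
... | tri< i<i′ i≢i′ _ = inj₁ (ℕₚ.<⇒≤ i<i′ , λ i≡i′ → contradiction i≡i′ i≢i′)
... | tri> _ i≢i′ i′<i = inj₂ (ℕₚ.<⇒≤ i′<i , λ i′≡i → contradiction (sym i′≡i) i≢i′)
... | tri≈ _ refl _ with ℕₚ.≤-total j j′
...   | inj₁ j≤j′ = inj₂ (ℕₚ.≤-refl , λ _ → j≤j′)
...   | inj₂ j′≤j = inj₁ (ℕₚ.≤-refl , λ _ → j′≤j)

≤↙-trans : Transitive _≤↙_
≤↙-trans {x} {y} {z} (x≤y , x≡y⇒) (y≤z , y≡z⇒) = ℕₚ.≤-trans x≤y y≤z , λ x≡z →
  let y≡z = ℕₚ.≤-antisym y≤z (subst (ℕ._≤ row y) x≡z x≤y)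
  in ℕₚ.≤-trans (y≡z⇒ y≡z) (x≡y⇒ (trans x≡z (sym y≡z)))

≤↙-antisym : ∀ {c d} → c ≤↙ d → d ≤↙ c → c ≡ d
≤↙-antisym {i , j} {i′ , j′} (i≤i′ , i≡i′⇒) (i′≤i , i′≡i⇒) with ℕₚ.≤-antisym i≤i′ i′≤i
... | refl = cong (i ,_) (ℕₚ.≤-antisym (i′≡i⇒ refl) (i≡i′⇒ refl))

≤↙⇒≥↗ : ∀ {c d} → c ≤↙ d → d ≤↗ c
≤↙⇒≥↗ (≤ , ≡⇒) = ≤ , ≡⇒ ∘ sym

≥↗⇒≤↙ : ∀ {c d} → d ≤↗ c → c ≤↙ d
≥↗⇒≤↙ (≤ , ≡⇒) = ≤ , ≡⇒ ∘ sym

≤↗-total : Total _≤↗_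
≤↗-total x y = Sum.map ≤↙⇒≥↗ ≤↙⇒≥↗ (≤↙-total y x)

≤↗-trans : Transitive _≤↗_
≤↗-trans x≤y y≤z = ≤↙⇒≥↗ (≤↙-trans (≥↗⇒≤↙ y≤z) (≥↗⇒≤↙ x≤y))

maximum : ∀ {A : Set} {_≤_ : Rel A 0ℓ} → Total _≤_ → Transitive _≤_ →
          ∀ x xs → Σ A λ m → m ∈ x ∷ xs × (∀ d → d ∈ x ∷ xs → d ≤ m)
maximum total _ x [] = x , here refl , λ { _ (here refl) → Sum.reduce (total x x) }
maximum total ≤-trans x (y ∷ ys) with maximum total ≤-trans y ys
... | m , m∈ , ≤m with total x m
...   | inj₁ x≤m = m , there m∈ , λ { _ (here refl) → x≤m ; d (there d∈) → ≤m d d∈ }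
...   | inj₂ m≤x = x , here refl , λ { _ (here refl) → Sum.reduce (total x x)
                                     ; d (there d∈) → ≤-trans (≤m d d∈) m≤x }

init-exists : ∀ {B} → NonEmpty B → Σ Cell (IsInit B)
init-exists {x ∷ xs} _ = maximum ≤↙-total ≤↙-trans x xs

fin-exists : ∀ {B} → NonEmpty B → Σ Cell (IsFin B)
fin-exists {x ∷ xs} _ = maximum ≤↗-total ≤↗-trans x xs

init-unique : ∀ {B c c′} → IsInit B c → IsInit B c′ → c ≡ c′
init-unique (c∈ , c-max) (c′∈ , c′-max) = ≤↙-antisym (c′-max _ c∈) (c-max _ c′∈)

fin-unique : ∀ {B c c′} → IsFin B c → IsFin B c′ → c ≡ c′
fin-unique (c∈ , c-max) (c′∈ , c′-max) = ≤↙-antisym (≥↗⇒≤↙ (c-max _ c′∈)) (≥↗⇒≤↙ (c′-max _ c∈))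

module _ {P : Cell → Set} (convex : Convex P) where

  ≤↙-greatest⇒τ-least : ∀ {c} → P c → (∀ d → P d → d ≤↙ c) → ∀ d → P d → τ c ℤ.≤ τ d
  ≤↙-greatest⇒τ-least {i , j} pc greatest (i′ , j′) pd with greatest (i′ , j′) pd | j ℕ.≤? j′
  ... | i′≤i , _ | yes j≤j′ = +≤+⇒τ≤τ i j i′ j′ (ℕₚ.+-mono-≤ j≤j′ i′≤i)
  ... | i′≤i , _ | no j≰j′ = contradiction (proj₂ (greatest (i , j′) between) refl) j≰j′
    where
    between : P (i , j′)
    between = convex (i′ , j′) (i , j′) (i , j) pd pc (i′≤i , ℕₚ.≤-refl) (ℕₚ.≤-refl , ℕₚ.<⇒≤ (ℕₚ.≰⇒> j≰j′))

  ≤↗-greatest⇒τ-greatest : ∀ {c} → P c → (∀ d → P d → d ≤↗ c) → ∀ d → P d → τ d ℤ.≤ τ c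
  ≤↗-greatest⇒τ-greatest {i , j} pc greatest (i′ , j′) pd with greatest (i′ , j′) pd | j′ ℕ.≤? j
  ... | i≤i′ , _ | yes j′≤j = +≤+⇒τ≤τ i′ j′ i j (ℕₚ.+-mono-≤ j′≤j i≤i′)
  ... | i≤i′ , _ | no j′≰j = contradiction (proj₂ (greatest (i , j′) between) refl) j′≰j
    where
    between : P (i , j′)
    between = convex (i , j) (i , j′) (i′ , j′) pc pd (ℕₚ.≤-refl , ℕₚ.<⇒≤ (ℕₚ.≰⇒> j′≰j)) (i≤i′ , ℕₚ.≤-refl)

module BorderStrip {B : List Cell} (strip : IsBorderStrip B) where

  convex : Convex (_∈ B)
  convex = skewShape-convex (proj₁ (proj₂ strip))

  no2×2 : No2×2 (_∈ B)
  no2×2 = proj₂ (proj₂ (proj₂ strip))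

  private
    connected : Connected B
    connected = proj₁ (proj₂ (proj₂ strip))

  init-left-or-below : ∀ {s c} → IsInit B s → c ∈ B → τ s ≢ τ c →
                       (row c , col c ∸ 1) ∈ B ⊎ (suc (row c) , col c) ∈ B
  init-left-or-below {s} {c} (s∈ , s-greatest) c∈ τs≢τc
    with reach-intermediate-content (ℤ.pred (τ c)) (connected s c s∈ c∈) s∈ τs≤τc-1 (ℤₚ.i≤j⇒pred[i]≤j ℤₚ.≤-refl)
    where
    τs≤τc-1 : τ s ℤ.≤ ℤ.pred (τ c)
    τs≤τc-1 = ℤₚ.i<j⇒i≤pred[j] (ℤₚ.≤∧≢⇒< (≤↙-greatest⇒τ-least convex s∈ s-greatest c c∈) τs≢τc)
  ... | d , d∈ , τd≡τc-1
    with consecutive-diagonals convex no2×2 c∈ d∈ (sym (trans (cong ℤ.suc τd≡τc-1) (ℤₚ.suc-pred (τ c))))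
  ... | inj₁ refl = inj₁ d∈
  ... | inj₂ refl = inj₂ d∈

  fin-above-or-right : ∀ {f c} → IsFin B f → c ∈ B → τ f ≢ τ c →
                       (row c ∸ 1 , col c) ∈ B ⊎ (row c , suc (col c)) ∈ B
  fin-above-or-right {f} {c} (f∈ , f-greatest) c∈ τf≢τc
    with reach-intermediate-content (ℤ.suc (τ c)) (connected c f c∈ f∈) c∈ (ℤₚ.i≤suc[i] (τ c)) τc+1≤τf
    where
    τc+1≤τf : ℤ.suc (τ c) ℤ.≤ τ f
    τc+1≤τf = ℤₚ.i<j⇒suc[i]≤j (ℤₚ.≤∧≢⇒< (≤↗-greatest⇒τ-greatest convex f∈ f-greatest c c∈) (τf≢τc ∘ sym))
  ... | d , d∈ , τd≡τc+1 with consecutive-diagonals convex no2×2 d∈ c∈ τd≡τc+1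
  ... | inj₁ refl = inj₂ d∈
  ... | inj₂ refl = inj₁ d∈

-- Parity of snakes

data Even : ℕ → Set where
  even-0 : Even 0
  even-2+ : ∀ {n} → Even n → Even (suc (suc n))

filter-pair-even : ∀ {A : Set} {P : A → Set} (P? : Decidable P) {a b} →
                   (P a → P b) → (P b → P a) → ∀ rest →
                   Even (length (filter P? rest)) → Even (length (filter P? (a ∷ b ∷ rest)))
filter-pair-even {P = P} P? {a} {b} a⇒b b⇒a rest ev = by-cases (P? a)
  where
  by-cases : Dec (P a) → Even (length (filter P? (a ∷ b ∷ rest)))
  by-cases (yes pa) = subst (Even ∘ length)
    (sym (trans (Listₚ.filter-accept P? pa) (cong (a ∷_) (Listₚ.filter-accept P? (a⇒b pa)))))
    (even-2+ ev)
  by-cases (no ¬pa) = subst (Even ∘ length)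
    (sym (trans (Listₚ.filter-reject P? ¬pa) (Listₚ.filter-reject P? (¬pa ∘ b⇒a))))
    ev

filter-pairs-even : ∀ {A : Set} {P : A → Set} (P? : Decidable P) (x y : ℕ → A) →
                    (∀ m → P (x m) → P (y m)) → (∀ m → P (y m) → P (x m)) →
                    ∀ ms → Even (length (filter P? (concat (map (λ m → x m ∷ y m ∷ []) ms))))
filter-pairs-even P? x y x⇒y y⇒x [] = even-0
filter-pairs-even P? x y x⇒y y⇒x (m ∷ ms) =
  filter-pair-even P? (x⇒y m) (y⇒x m) _ (filter-pairs-even P? x y x⇒y y⇒x ms)

half-odd : ∀ {n} → Even n → half (suc n) ≡ nothing
half-odd even-0 = refl
half-odd (even-2+ ev) = cong (Maybe.map suc) (half-odd ev)

symOf-nothing : ∀ e → symOf e nothing ≡ O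
symOf-nothing (H _ _) = refl
symOf-nothing (V _ _) = refl

snakeSym-even : ∀ la mu e → Even (length (snake la mu e)) → snakeSym la mu e ≡ O
snakeSym-even la mu e ev with length (snake la mu e) | ev
... | zero        | _           = refl
... | suc (suc n) | even-2+ ev′ = trans (cong (symOf e) (half-odd ev′)) (symOf-nothing e)

snake-inside : ∀ {la mu} e → InSkew la mu (edgeCell e) →
               snake la mu e ≡ filter (inSkew? la mu) (snakeCandidates e)
snake-inside {la} {mu} e inside rewrite dec-true (inSkew? la mu (edgeCell e)) inside = refl

snakeSym≢O⇒inside : ∀ la mu e → snakeSym la mu e ≢ O → InSkew la mu (edgeCell e)
snakeSym≢O⇒inside la mu e ≢O = decidable-stable (inSkew? la mu (edgeCell e)) λ outside →
  ≢O (snakeSym-even la mu e (subst (Even ∘ length) (sym (snake-outside outside)) even-0))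
  where
  snake-outside : ¬ InSkew la mu (edgeCell e) → snake la mu e ≡ []
  snake-outside outside rewrite dec-false (inSkew? la mu (edgeCell e)) outside = refl

vertical-not-L : ∀ la mu i j → ¬ IsLType (snakeSym la mu (V i j))
vertical-not-L la mu i j with length (snake la mu (V i j))
... | zero = λ ()
... | suc n with half n
...   | just _  = λ ()
...   | nothing = λ ()

horizontal-not-R : ∀ la mu i j → ¬ IsRType (snakeSym la mu (H i j))
horizontal-not-R la mu i j with length (snake la mu (H i j))
... | zero = λ ()
... | suc n with half n
...   | just _  = λ ()
...   | nothing = λ ()

injective⇒surjective : ∀ {n} (f : Fin n → Fin n) → (∀ a b → f a ≡ f b → a ≡ b) →
                       ∀ k → Σ (Fin n) λ a → f a ≡ k
injective⇒surjective {suc n} f injective k with Finₚ.any? (λ a → f a Finₚ.≟ k)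
... | yes hit = hit
... | no miss = contradiction (Finₚ.injective⇒≤ punched-injective) ℕₚ.1+n≰n
  where
  k≢f : ∀ a → k ≢ f a
  k≢f a k≡fa = miss (a , sym k≡fa)
  punched : Fin (suc n) → Fin n
  punched a = Fin.punchOut (k≢f a)
  punched-injective : Injective _≡_ _≡_ punched
  punched-injective {a} {b} eq = injective a b (Finₚ.punchOut-injective (k≢f a) (k≢f b) eq)

-- InP D and InQ D are, definitionally, Marked IsInit D and Marked IsFin D.
Marked : (List Cell → Cell → Set) → List (List Cell) → ℤ → Set
Marked X D z = Σ (Fin (length D)) λ k → Σ Cell λ c → X (lookup D k) c × z ≡ τ c

module _ (X : List Cell → Cell → Set) (X-unique : ∀ {B c c′} → X B c → X B c′ → c ≡ c′)
         {D : List (List Cell)} where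

  marked? : (∀ k → Σ Cell (X (lookup D k))) → ∀ z → Dec (Marked X D z)
  marked? extremal z with Finₚ.any? (λ k → z ℤ.≟ τ (proj₁ (extremal k)))
  ... | yes (k , z≡) = yes (k , proj₁ (extremal k) , proj₂ (extremal k) , z≡)
  ... | no none = no λ (k , c , xc , z≡τc) →
    none (k , trans z≡τc (cong τ (X-unique xc (proj₂ (extremal k)))))

  marked-contents : (val : Fin (length D) → ℤ) → (∀ i i′ → val i ≡ val i′ → i ≡ i′) →
                    (∀ i → Marked X D (val i)) →
                    ∀ z → Marked X D z ⇔ Σ (Fin (length D)) (λ i → z ≡ val i)
  marked-contents val val-injective marks z = mk⇔ to from
    where
    strip : Fin (length D) → Fin (length D)
    strip i = proj₁ (marks i)

    val≡τ : ∀ i {k c} → strip i ≡ k → X (lookup D k) c → val i ≡ τ c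
    val≡τ i refl xc = let (_ , _ , xc′ , val≡τc′) = marks i in trans val≡τc′ (cong τ (X-unique xc′ xc))

    strip-injective : ∀ i i′ → strip i ≡ strip i′ → i ≡ i′
    strip-injective i i′ same = let (_ , _ , xc , _) = marks i in
      val-injective i i′ (trans (val≡τ i refl xc) (sym (val≡τ i′ (sym same) xc)))

    to : Marked X D z → Σ (Fin (length D)) (λ i → z ≡ val i)
    to (k , c , xc , z≡τc) = let (i , strip-i≡k) = injective⇒surjective strip strip-injective k in
      i , trans z≡τc (sym (val≡τ i strip-i≡k xc))

    from : Σ (Fin (length D)) (λ i → z ≡ val i) → Marked X D z
    from (i , z≡val) = let (k , c , xc , val≡τc) = marks i in k , c , xc , trans z≡val val≡τc

-- Strips starting and ending at the L- and R-positions

suc-∸-suc : ∀ {m n} → suc m ℕ.≤ n → suc (n ∸ suc m) ≡ n ∸ m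
suc-∸-suc le = sym (ℕₚ.+-∸-assoc 1 le)

∸-suc : ∀ n m → n ∸ suc m ≡ n ∸ m ∸ 1
∸-suc n m = trans (cong (n ∸_) (ℕₚ.+-comm 1 m)) (sym (ℕₚ.∸-+-assoc n m 1))

τ-horizontal-edge : ∀ a b {t s ε} → startDiag (H a b) ≡ s - + 1 + (+ t - + 1) → s ≡ ε →
                    τ (a , b) ≡ ε + + t - + 1
τ-horizontal-edge a b {t} {s} start refl = begin
  τ (a , b)                     ≡⟨ add-back (+ b) (+ a) ⟩
  startDiag (H a b) + + 1       ≡⟨ cong (_+ + 1) start ⟩
  s - + 1 + (+ t - + 1) + + 1   ≡⟨ collect s (+ t) ⟩
  s + + t - + 1                 ∎
  where
  open ≡-Reasoning
  add-back : ∀ b a → b - a ≡ b - ℤ.1ℤ - a + ℤ.1ℤ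
  add-back = solve-∀
  collect : ∀ s t → s - ℤ.1ℤ + (t - ℤ.1ℤ) + ℤ.1ℤ ≡ s + t - ℤ.1ℤ
  collect = solve-∀

τ-vertical-edge : ∀ a b {t s ε} → startDiag (V a b) ≡ s - + 1 + (+ t - + 1) → s ≡ ε →
                  τ (a , b) ≡ ε + + t - + 2
τ-vertical-edge a b {t} {s} start refl = trans start (collect s (+ t))
  where
  collect : ∀ s t → s - ℤ.1ℤ + (t - ℤ.1ℤ) ≡ s + t - (ℤ.1ℤ + ℤ.1ℤ)
  collect = solve-∀

shift-injective : ∀ e c {m n} → e + + m - c ≡ e + + n - c → m ≡ n
shift-injective e c {m} {n} eq = ℤₚ.+-injective (begin
  + m                 ≡⟨ recover e (+ m) c ⟩
  e + + m - c - e + c ≡⟨ cong (λ z → z - e + c) eq ⟩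
  e + + n - c - e + c ≡⟨ recover e (+ n) c ⟨
  + n                 ∎)
  where
  open ≡-Reasoning
  recover : ∀ e a c → a ≡ e + a - c - e + c
  recover = solve-∀

module Decomposition {la mu : List ℕ} (pla : IsPartition la) (pmu : IsPartition mu)
                     {D : List (List Cell)} (bsd : IsBSD la mu D) where

  strip : ∀ k → IsBorderStrip (lookup D k)
  strip k = All.lookup (proj₁ bsd) (∈-lookup k)

  inside : ∀ k {c} → c ∈ lookup D k → InSkew la mu c
  inside k = proj₁ (proj₂ bsd) k _

  disjoint : ∀ k l {c} → c ∈ lookup D k → c ∈ lookup D l → k ≡ l
  disjoint k l = proj₁ (proj₂ (proj₂ bsd)) k l _

  cover : ∀ c → InSkew la mu c → Σ (Fin (length D)) λ k → c ∈ lookup D k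
  cover = proj₂ (proj₂ (proj₂ bsd))

  init-of : ∀ k → Σ Cell (IsInit (lookup D k))
  init-of k = init-exists (proj₁ (strip k))

  fin-of : ∀ k → Σ Cell (IsFin (lookup D k))
  fin-of k = fin-exists (proj₁ (strip k))

  S-convex : Convex (InSkew la mu)
  S-convex = InSkew-convex (proj₁ pla) (proj₁ pmu)

  partner-in-same-strip : (x y : ℕ → Cell) →
    (∀ m → InSkew la mu (x (suc m)) → InSkew la mu (x m)) →
    (∀ k → x 0 ∈ lookup D k → y 0 ∈ lookup D k) →
    (∀ m k → x (suc m) ∈ lookup D k → y (suc m) ∈ lookup D k ⊎ y m ∈ lookup D k) →
    (∀ m k → x (suc m) ∈ lookup D k → ¬ x m ∈ lookup D k) →
    ∀ m k → x m ∈ lookup D k → y m ∈ lookup D k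
  partner-in-same-strip x y x-suc⇒x start continue sparse = go
    where
    go : ∀ m k → x m ∈ lookup D k → y m ∈ lookup D k
    go zero k x∈ = start k x∈
    go (suc m) k x∈ with continue m k x∈
    ... | inj₁ y∈ = y∈
    ... | inj₂ y′∈ with cover (x m) (x-suc⇒x m (inside k x∈))
    ...   | k′ , x′∈ with disjoint k k′ y′∈ (go m k′ x′∈)
    ...     | refl = contradiction x′∈ (sparse m k x∈)

  module Diagonal {i j : ℕ} (ij∈ : InSkew la mu (i , j)) where

    x : ℕ → Cell
    x m = (i ∸ m , j ∸ m)

    x≼ij : ∀ m → x m ≼ (i , j)
    x≼ij m = ℕₚ.m∸n≤m i m , ℕₚ.m∸n≤m j m

    x-suc⇒x : ∀ m → InSkew la mu (x (suc m)) → InSkew la mu (x m)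
    x-suc⇒x m x′∈ = S-convex (x (suc m)) (x m) (i , j) x′∈ ij∈
      (ℕₚ.∸-monoʳ-≤ i (ℕₚ.n≤1+n m) , ℕₚ.∸-monoʳ-≤ j (ℕₚ.n≤1+n m)) (x≼ij m)

    x∈⇒< : ∀ {m} → InSkew la mu (x m) → m ℕ.< i × m ℕ.< j
    x∈⇒< ((1≤i∸m , 1≤j∸m , _) , _) = ℕₚ.m∸n≢0⇒n<m (ℕₚ.>⇒≢ 1≤i∸m) , ℕₚ.m∸n≢0⇒n<m (ℕₚ.>⇒≢ 1≤j∸m)

    τ-x : ∀ m → InSkew la mu (x m) → τ (x m) ≡ τ (i , j)
    τ-x m x∈ = let (m<i , m<j) = x∈⇒< x∈ in τ-diagonal i j m (ℕₚ.<⇒≤ m<i) (ℕₚ.<⇒≤ m<j)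

    x-sparse : ∀ m k → x (suc m) ∈ lookup D k → ¬ x m ∈ lookup D k
    x-sparse m k x′∈ x∈ = let (m<i , m<j) = x∈⇒< (inside k x′∈) in
      no-increasing-pair (BorderStrip.convex (strip k)) (BorderStrip.no2×2 (strip k)) x′∈ x∈
        (ℕₚ.∸-monoʳ-< (ℕₚ.n<1+n m) (ℕₚ.<⇒≤ m<i)) (ℕₚ.∸-monoʳ-< (ℕₚ.n<1+n m) (ℕₚ.<⇒≤ m<j))

    in-pairs : (y : ℕ → Cell) →
      (∀ k → x 0 ∈ lookup D k → y 0 ∈ lookup D k) →
      (∀ m k → x (suc m) ∈ lookup D k → y (suc m) ∈ lookup D k ⊎ y m ∈ lookup D k) →
      ∀ m → InSkew la mu (x m) → InSkew la mu (y m)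
    in-pairs y start continue m x∈ = let (k , x∈k) = cover (x m) x∈ in
      inside k (partner-in-same-strip x y x-suc⇒x start continue x-sparse m k x∈k)

    horizontal-snake-even : ¬ InDiag la (suc i , j) → ¬ InP D (τ (i , j)) →
                            Even (length (snake la mu (H i j)))
    horizontal-snake-even outside no-init =
      subst (Even ∘ length) (sym (snake-inside (H i j) ij∈))
        (filter-pairs-even (inSkew? la mu) x y (in-pairs y start continue) y⇒x (upTo i))
      where
      y : ℕ → Cell
      y m = (i ∸ m , j ∸ m ∸ 1)

      left-or-below : ∀ m k → x m ∈ lookup D k →
                      y m ∈ lookup D k ⊎ (suc (i ∸ m) , j ∸ m) ∈ lookup D k
      left-or-below m k x∈ = let (s , s-init) = init-of k in
        BorderStrip.init-left-or-below (strip k) s-init x∈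
          (λ τs≡τx → no-init (k , s , s-init , sym (trans τs≡τx (τ-x m (inside k x∈)))))

      start : ∀ k → x 0 ∈ lookup D k → y 0 ∈ lookup D k
      start k x∈ = Sum.[ id , (λ below∈ → contradiction (proj₁ (inside k below∈)) outside) ] (left-or-below 0 k x∈)

      continue : ∀ m k → x (suc m) ∈ lookup D k → y (suc m) ∈ lookup D k ⊎ y m ∈ lookup D k
      continue m k x∈ = Sum.map₂ (subst (_∈ lookup D k) below≡y) (left-or-below (suc m) k x∈)
        where
        below≡y : (suc (i ∸ suc m) , j ∸ suc m) ≡ y m
        below≡y = cong₂ _,_ (suc-∸-suc (ℕₚ.<⇒≤ (proj₁ (x∈⇒< {suc m} (inside k x∈))))) (∸-suc j m)

      y⇒x : ∀ m → InSkew la mu (y m) → InSkew la mu (x m)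
      y⇒x m y∈ = S-convex (y m) (x m) (i , j) y∈ ij∈ (ℕₚ.≤-refl , ℕₚ.m∸n≤m (j ∸ m) 1) (x≼ij m)

    vertical-snake-even : ¬ InDiag la (i , suc j) → ¬ InQ D (τ (i , j)) →
                          Even (length (snake la mu (V i j)))
    vertical-snake-even outside no-fin =
      subst (Even ∘ length) (sym (snake-inside (V i j) ij∈))
        (filter-pairs-even (inSkew? la mu) x y (in-pairs y start continue) y⇒x (upTo i))
      where
      y : ℕ → Cell
      y m = (i ∸ m ∸ 1 , j ∸ m)

      above-or-right : ∀ m k → x m ∈ lookup D k →
                       y m ∈ lookup D k ⊎ (i ∸ m , suc (j ∸ m)) ∈ lookup D k
      above-or-right m k x∈ = let (f , f-fin) = fin-of k in
        BorderStrip.fin-above-or-right (strip k) f-fin x∈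
          (λ τf≡τx → no-fin (k , f , f-fin , sym (trans τf≡τx (τ-x m (inside k x∈)))))

      start : ∀ k → x 0 ∈ lookup D k → y 0 ∈ lookup D k
      start k x∈ = Sum.[ id , (λ right∈ → contradiction (proj₁ (inside k right∈)) outside) ] (above-or-right 0 k x∈)

      continue : ∀ m k → x (suc m) ∈ lookup D k → y (suc m) ∈ lookup D k ⊎ y m ∈ lookup D k
      continue m k x∈ = Sum.map₂ (subst (_∈ lookup D k) right≡y) (above-or-right (suc m) k x∈)
        where
        right≡y : (i ∸ suc m , suc (j ∸ suc m)) ≡ y m
        right≡y = cong₂ _,_ (∸-suc i m) (suc-∸-suc (ℕₚ.<⇒≤ (proj₂ (x∈⇒< {suc m} (inside k x∈)))))

      y⇒x : ∀ m → InSkew la mu (y m) → InSkew la mu (x m)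
      y⇒x m y∈ = S-convex (y m) (x m) (i , j) y∈ ij∈ (ℕₚ.m∸n≤m (i ∸ m) 1 , ℕₚ.≤-refl) (x≼ij m)

  L-snake⇒InP : ∀ {i j} → ¬ InDiag la (suc i , j) → IsLType (snakeSym la mu (H i j)) → InP D (τ (i , j))
  L-snake⇒InP {i} {j} outside isL = decidable-stable (marked? IsInit init-unique {D} init-of (τ (i , j))) λ no-init →
    subst IsLType (snakeSym-even la mu (H i j) (Diagonal.horizontal-snake-even ij∈ outside no-init)) isL
    where
    ij∈ : InSkew la mu (i , j)
    ij∈ = snakeSym≢O⇒inside la mu (H i j) (λ ≡O → subst IsLType ≡O isL)

  R-snake⇒InQ : ∀ {i j} → ¬ InDiag la (i , suc j) → IsRType (snakeSym la mu (V i j)) → InQ D (τ (i , j))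
  R-snake⇒InQ {i} {j} outside isR = decidable-stable (marked? IsFin fin-unique {D} fin-of (τ (i , j))) λ no-fin →
    subst IsRType (snakeSym-even la mu (V i j) (Diagonal.vertical-snake-even ij∈ outside no-fin)) isR
    where
    ij∈ : InSkew la mu (i , j)
    ij∈ = snakeSym≢O⇒inside la mu (V i j) (λ ≡O → subst IsRType ≡O isR)

  bottomLeft-content : ∀ {s ε} → BottomLeftCell la mu s → IsMinContent la mu ε → τ s ≡ ε
  bottomLeft-content {s} (s∈ , s-greatest) ((c , c∈ , τc≡ε) , ε-least) = ℤₚ.≤-antisym
    (subst (τ s ℤ.≤_) τc≡ε (≤↙-greatest⇒τ-least S-convex s∈ s-greatest c c∈)) (ε-least _ s∈)

  L-position⇒InP : ∀ {ε t} → IsMinContent la mu ε → QIsL la mu t → InP D (ε + + t - + 1)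
  L-position⇒InP _ (V a b , _ , isL) = contradiction isL (vertical-not-L la mu a b)
  L-position⇒InP minε (H a b , (s , _ , bottom-left , _ , _ , _ , (_ , outside) , start) , isL) =
    subst (InP D) (τ-horizontal-edge a b start (bottomLeft-content bottom-left minε)) (L-snake⇒InP outside isL)

  R-position⇒InQ : ∀ {ε t} → IsMinContent la mu ε → QIsR la mu t → InQ D (ε + + t - + 2)
  R-position⇒InQ _ (H a b , _ , isR) = contradiction isR (horizontal-not-R la mu a b)
  R-position⇒InQ minε (V a b , (s , _ , bottom-left , _ , _ , _ , (_ , outside) , start) , isR) =
    subst (InQ D) (τ-vertical-edge a b start (bottomLeft-content bottom-left minε)) (R-snake⇒InQ outside isR)

proposition3p1 : (la mu : List ℕ) → IsPartition la → IsPartition mu → mu ⊆ₚ la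
    → (D : List (List Cell)) → IsMinimalBSD la mu D
    → (ε : ℤ) → IsMinContent la mu ε
    → (w y : Fin (length D) → ℕ) → IsIntervalSet la mu (length D) w y
    → NoCrossings (length D) w y
    → (∀ z → InP D z ⇔ Σ (Fin (length D)) (λ i → z ≡ ε + (+ w i) - (+ 1)))
      × (∀ z → InQ D z ⇔ Σ (Fin (length D)) (λ i → z ≡ ε + (+ y i) - (+ 2)))
proposition3p1 la mu pla pmu _ D (bsd , _) ε minε w y (w-injective , y-injective , _ , _ , L-at , R-at) _ =
  marked-contents IsInit init-unique {D} (λ i → ε + + w i - + 1)
    (λ i i′ → w-injective i i′ ∘ shift-injective ε (+ 1)) (λ i → L-position⇒InP minε (L-at i)) ,
  marked-contents IsFin fin-unique {D} (λ i → ε + + y i - + 2)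
    (λ i i′ → y-injective i i′ ∘ shift-injective ε (+ 2)) (λ i → R-position⇒InQ minε (R-at i))
  where open Decomposition pla pmu bsd
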